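{- Let $P$ be a positive logic, let $L=\mathrm{Int}+P$, and let $\mathcal{R}$ be a set of positive multiple-conclusion rules. (i) If $\mathcal{R}$ is a basis of $L$-admissible rules, then $\mathcal{R}$ is a basis of $P$-admissible rules; if moreover $\mathcal{R}$ is $L$-independent, then it is $P$-independent. (ii) If $\mathcal{R}$ is a basis of $P$-admissible rules, then every positive multiple-conclusion rule admissible for $L$ $L$-follows from $\mathcal{R}$.
   Context: Formulas are built from countably many propositional variables using $\land,\lor,\to$ and the constant $\bot$. Positive formulas are those not containing $\bot$. $\mathrm{Int}$ is the set of intuitionistic propositional theorems and $\mathrm{Int}^+$ its positive members. A positive logic is a set of positive formulas containing $\mathrm{Int}^+$ and closed under modus ponens and positive substitutions (maps of variables to positive formulas). $\mathrm{Int}+P$ is the least set of formulas containing $\mathrm{Int}\cup P$ and closed under modus ponens and substitutions. A multiple-conclusion rule $\Gamma/\Delta$ is a pair of finite sets of formulas; it is positive if all its formulas are positive. It is admissible for $L$ if every substitution $\sigma$ with $\sigma(A)\in L$ for all $A\in\Gamma$ has $\sigma(B)\in L$ for some $B\in\Delta$. A positive rule is admissible for $P$ if every positive substitution $\sigma$ with $\sigma(A)\in P$ for all $A\in\Gamma$ has $\sigma(B)\in P$ for some $B\in\Delta$. Brouwerian algebras are algebras $(A,\land,\lor,\to,1)$ with $(A,\land,\lor)$ a distributive lattice with top $1$ and $\to$ relative pseudo-complementation. Heyting algebras additionally have a least element $0$. A rule is valid in an algebra if every valuation sending all premises to $1$ sends some conclusion to $1$. $V_L$ (resp. $V_P$)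 is the variety of Heyting (resp. Brouwerian) algebras validating all formulas of $L$ (resp. $P$). For $X\in\{L,P\}$, a rule $r$ $X$-follows from a set of rules $\mathcal{R}$ if every algebra of $V_X$ validating all rules of $\mathcal{R}$ validates $r$. A set of $X$-admissible rules is a basis of $X$-admissible rules if every $X$-admissible rule $X$-follows from it. It is $X$-independent if no member $X$-follows from the others. -}

module Defs where

open import Level using (0ℓ)
open import Data.Nat using (ℕ)
open import Data.Product using (Σ; _×_; ∃; _,_; proj₁; proj₂)
open import Data.List using (List; []; _∷_)
open import Data.List.Relation.Unary.All as All using (All)
open import Data.List.Relation.Unary.Any using (Any)
open import Data.List.Membership.Propositional using (_∈_)
open import Relation.Nullary using (¬_)
open import Relation.Binary.Core using (Rel)
open import Relation.Binary.Definitions using (Maximum)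
open import Relation.Binary.Lattice.Definitions using (Exponential)
open import Relation.Binary.Lattice.Structures using (IsLattice)
open import Relation.Binary.Lattice.Bundles using (HeytingAlgebra)
open import Algebra.Core using (Op₂)
open import Function.Bundles using (_⇔_)

infixr 7 _∧'_
infixr 6 _∨'_
infixr 5 _⇒_

data Fm : Set where
  var  : ℕ → Fm
  _∧'_ : Fm → Fm → Fm
  _∨'_ : Fm → Fm → Fm
  _⇒_  : Fm → Fm → Fm
  ⊥'   : Fm

data Positive : Fm → Set where
  var : ∀ n → Positive (var n)
  _∧'_ : ∀ {A B} → Positive A → Positive B → Positive (A ∧' B)
  _∨'_ : ∀ {A B} → Positive A → Positive B → Positive (A ∨' B)
  _⇒_  : ∀ {A B} → Positive A → Positive B → Positive (A ⇒ B)

Subst : Set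
Subst = ℕ → Fm

sub : Subst → Fm → Fm
sub σ (var n)  = σ n
sub σ (A ∧' B) = sub σ A ∧' sub σ B
sub σ (A ∨' B) = sub σ A ∨' sub σ B
sub σ (A ⇒ B)  = sub σ A ⇒ sub σ B
sub σ ⊥'       = ⊥'

PositiveSubst : Subst → Set
PositiveSubst σ = ∀ n → Positive (σ n)

data Int : Fm → Set where
  ax1 : ∀ A B → Int (A ⇒ B ⇒ A)
  ax2 : ∀ A B C → Int ((A ⇒ B ⇒ C) ⇒ (A ⇒ B) ⇒ A ⇒ C)
  ax3 : ∀ A B → Int (A ∧' B ⇒ A)
  ax4 : ∀ A B → Int (A ∧' B ⇒ B)
  ax5 : ∀ A B → Int (A ⇒ B ⇒ A ∧' B)
  ax6 : ∀ A B → Int (A ⇒ A ∨' B)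
  ax7 : ∀ A B → Int (B ⇒ A ∨' B)
  ax8 : ∀ A B C → Int ((A ⇒ C) ⇒ (B ⇒ C) ⇒ A ∨' B ⇒ C)
  ax9 : ∀ A → Int (⊥' ⇒ A)
  mp  : ∀ {A B} → Int (A ⇒ B) → Int A → Int B

IntPos : Fm → Set
IntPos A = Int A × Positive A

record PositiveLogic (P : Fm → Set) : Set where
  field
    positive  : ∀ A → P A → Positive A
    containsInt⁺ : ∀ A → IntPos A → P A
    closedMP  : ∀ A B → P (A ⇒ B) → P A → P B
    closedSubst : ∀ σ → PositiveSubst σ → ∀ A → P A → P (sub σ A)

data IntPlus (P : Fm → Set) : Fm → Set where
  int  : ∀ {A} → Int A → IntPlus P A
  extra : ∀ {A} → P A → IntPlus P A
  mp   : ∀ {A B} → IntPlus P (A ⇒ B) → IntPlus P A → IntPlus P B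
  subst : ∀ σ {A} → IntPlus P A → IntPlus P (sub σ A)

-- Multiple-conclusion rules  Γ / Δ  (finite sets given as lists)

record Rule : Set where
  constructor _/_
  field
    prem  : List Fm
    concl : List Fm
open Rule public

PositiveRule : Rule → Set
PositiveRule r = All Positive (prem r) × All Positive (concl r)

SameRule : Rule → Rule → Set
SameRule r r' = (∀ A → (A ∈ prem r ⇔ A ∈ prem r')) × (∀ A → (A ∈ concl r ⇔ A ∈ concl r'))

AdmissibleFor : (Fm → Set) → Rule → Set
AdmissibleFor L r = ∀ (σ : Subst) → All (λ A → L (sub σ A)) (prem r) → Any (λ B → L (sub σ B)) (concl r)

PAdmissible : (Fm → Set) → Rule → Set
PAdmissible P r = PositiveRule r × (∀ (σ : Subst) → PositiveSubst σ → All (λ A → P (sub σ A)) (prem r) → Any (λ B → P (sub σ B)) (concl r))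

-- Brouwerian algebras: lattices with top and relative pseudo-complement
-- (distributivity follows); same style as the stdlib HeytingAlgebra.

record IsBrouwerianAlgebra {A : Set} (_≈_ : Rel A 0ℓ) (_≤_ : Rel A 0ℓ)
    (_∨_ _∧_ _⇨_ : Op₂ A) (⊤ : A) : Set where
  field
    isLattice   : IsLattice _≈_ _≤_ _∨_ _∧_
    maximum     : Maximum _≤_ ⊤
    exponential : Exponential _≤_ _∧_ _⇨_

record BrouwerianAlgebra : Set₁ where
  field
    Carrier : Set
    _≈_ : Rel Carrier 0ℓ
    _≤_ : Rel Carrier 0ℓ
    _∨_ : Op₂ Carrier
    _∧_ : Op₂ Carrier
    _⇨_ : Op₂ Carrier
    ⊤   : Carrier
    isBrouwerianAlgebra : IsBrouwerianAlgebra _≈_ _≤_ _∨_ _∧_ _⇨_ ⊤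

withProofs : ∀ {xs : List Fm} → All Positive xs → List (Σ Fm Positive)
withProofs All.[] = []
withProofs (All._∷_ {x} px ps) = (x , px) ∷ withProofs ps

Heyting : Set₁
Heyting = HeytingAlgebra 0ℓ 0ℓ 0ℓ

module _ (H : Heyting) where
  open HeytingAlgebra H

  ⟦_⟧H : Fm → (ℕ → Carrier) → Carrier
  ⟦ var n ⟧H v  = v n
  ⟦ A ∧' B ⟧H v = ⟦ A ⟧H v ∧ ⟦ B ⟧H v
  ⟦ A ∨' B ⟧H v = ⟦ A ⟧H v ∨ ⟦ B ⟧H v
  ⟦ A ⇒ B ⟧H v  = ⟦ A ⟧H v ⇨ ⟦ B ⟧H v
  ⟦ ⊥' ⟧H v     = ⊥

  HValid : Rule → Set
  HValid r = ∀ (v : ℕ → Carrier) → All (λ A → ⟦ A ⟧H v ≈ ⊤) (prem r) → Any (λ B → ⟦ B ⟧H v ≈ ⊤) (concl r)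

  HValidFm : Fm → Set
  HValidFm A = ∀ (v : ℕ → Carrier) → ⟦ A ⟧H v ≈ ⊤

module _ (B : BrouwerianAlgebra) where
  open BrouwerianAlgebra B

  ⟦_⟧B : (A : Fm) → Positive A → (ℕ → Carrier) → Carrier
  ⟦ var n ⟧B (var .n) v = v n
  ⟦ A ∧' C ⟧B (p ∧' q) v = ⟦ A ⟧B p v ∧ ⟦ C ⟧B q v
  ⟦ A ∨' C ⟧B (p ∨' q) v = ⟦ A ⟧B p v ∨ ⟦ C ⟧B q v
  ⟦ A ⇒ C ⟧B (p ⇒ q) v = ⟦ A ⟧B p v ⇨ ⟦ C ⟧B q v

  BValid : (r : Rule) → PositiveRule r → Set
  BValid r (pp , pc) = ∀ (v : ℕ → Carrier) →
    All (λ x → ⟦ proj₁ x ⟧B (proj₂ x) v ≈ ⊤) (withProofs pp) →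
    Any (λ x → ⟦ proj₁ x ⟧B (proj₂ x) v ≈ ⊤) (withProofs pc)

  BValidFm : (A : Fm) → Positive A → Set
  BValidFm A pA = ∀ (v : ℕ → Carrier) → ⟦ A ⟧B pA v ≈ ⊤

InVL : (Fm → Set) → Heyting → Set
InVL P H = ∀ A → IntPlus P A → HValidFm H A

InVP : (Fm → Set) → BrouwerianAlgebra → Set
InVP P B = ∀ A (pA : Positive A) → P A → BValidFm B A pA

LFollows : (Fm → Set) → (Rule → Set) → Rule → Set₁
LFollows P ℛ r = ∀ (H : Heyting) → InVL P H → (∀ r' → ℛ r' → HValid H r') → HValid H r

PFollows : (Fm → Set) → (Rule → Set) → (r : Rule) → PositiveRule r → Set₁
PFollows P ℛ r pr = ∀ (B : BrouwerianAlgebra) → InVP P B →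
  (∀ r' (pr' : PositiveRule r') → ℛ r' → BValid B r' pr') → BValid B r pr

Others : (Rule → Set) → Rule → Rule → Set
Others ℛ r r' = ℛ r' × ¬ SameRule r' r

LBasis : (Fm → Set) → (Rule → Set) → Set₁
LBasis P ℛ = (∀ r → ℛ r → AdmissibleFor (IntPlus P) r)
           × (∀ r → AdmissibleFor (IntPlus P) r → LFollows P ℛ r)

PBasis : (Fm → Set) → (Rule → Set) → Set₁
PBasis P ℛ = (∀ r → ℛ r → PAdmissible P r)
           × (∀ r → (a : PAdmissible P r) → PFollows P ℛ r (proj₁ a))

LIndependent : (Fm → Set) → (Rule → Set) → Set₁
LIndependent P ℛ = ∀ r → ℛ r → ¬ LFollows P (Others ℛ r) r

PIndependent : (Fm → Set) → (Rule → Set) → Set₁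
PIndependent P ℛ = ∀ r (pr : PositiveRule r) → ℛ r → ¬ PFollows P (Others ℛ r) r pr

-- Reading ⊥ as a positive formula Q and each variable p as a positive τ p with
-- Q ⇒ τ p in P sends every theorem of Int + P to a theorem of P: ex falso, the
-- only axiom mentioning ⊥, becomes Q ⇒ (…), which follows from the Q ⇒ τ p.
-- For positive A, taking τ p = p ∨ Q with Q the conjunction of the variables of A
-- shows that Int + P is conservative over P; taking Q a fresh variable, and
-- substituting ⊥ for it again afterwards, turns L-unifiers of a positive rule into
-- P-unifiers and back. Hence L- and P-admissibility agree on positive rules.
-- Algebraically, the Brouwerian reduct of an algebra in V_L lies in V_P, and the
-- principal filter ↑g of an algebra in V_P is a Heyting algebra in V_L (bottom g)
-- computing positive formulas as the algebra does. Choosing g below the values of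
-- the finitely many variables of a rule, both constructions preserve and reflect
-- validity of positive rules, so L- and P-consequence agree on them as well.
module Submission where

open import Defs
open import Data.Product using (Σ; _×_; _,_; proj₁; proj₂; uncurry)
open import Data.Sum using (inj₁; inj₂)
open import Data.Nat using (ℕ; zero; suc; _⊔_; s≤s; z≤n; _≤?_) renaming (_≤_ to _≤ℕ_)
import Data.Nat.Properties as ℕₚ
open import Data.List using (List; []; _∷_; _++_)
open import Data.List.Relation.Unary.All as All using (All; []; _∷_)
open import Data.List.Relation.Unary.Any using (Any; here; there)
open import Data.List.Membership.Propositional using (_∈_; find; lose)
open import Data.List.Membership.Propositional.Properties using (∈-++⁺ˡ; ∈-++⁺ʳ)
open import Function using (_∘_; id; _⇔_; mk⇔; Equivalence)
import Function.Properties.Equivalence as ⇔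
open import Function.Related.TypeIsomorphisms using (→-cong-⇔)
open import Relation.Binary.PropositionalEquality as ≡ using (_≡_; refl; cong₂)
open import Relation.Nullary using (yes; no; contradiction)
open import Relation.Binary.Lattice.Bundles using (HeytingAlgebra)
open import Relation.Binary.Lattice.Structures using (IsLattice)
import Relation.Binary.Construct.On as On

private
  variable
    A B C Q X Y : Fm
    Γ : List Fm

All-map∈ : ∀ {xs} {T T′ : Fm → Set} → (∀ {x} → x ∈ xs → T x → T′ x) → All T xs → All T′ xs
All-map∈ f ts = All.tabulate (λ x∈ → f x∈ (All.lookup ts x∈))

Any-map∈ : ∀ {xs} {T T′ : Fm → Set} → (∀ {x} → x ∈ xs → T x → T′ x) → Any T xs → Any T′ xs
Any-map∈ f t = let _ , x∈ , tx = find t in lose x∈ (f x∈ tx)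

module _ {T : Fm → Set} {T′ : (A : Fm) → Positive A → Set} where

  All-withProofs : ∀ {xs} (pxs : All Positive xs) → (∀ {A} → A ∈ xs → ∀ p → T A ⇔ T′ A p) →
                   All T xs ⇔ All (uncurry T′) (withProofs pxs)
  All-withProofs [] _ = mk⇔ (λ _ → []) (λ _ → [])
  All-withProofs (p ∷ pxs) T⇔T′ = mk⇔
    (λ { (t ∷ ts) → Equivalence.to (T⇔T′ (here refl) p) t ∷ Equivalence.to rest ts })
    (λ { (t ∷ ts) → Equivalence.from (T⇔T′ (here refl) p) t ∷ Equivalence.from rest ts })
    where rest = All-withProofs pxs (λ A∈ → T⇔T′ (there A∈))

  Any-withProofs : ∀ {xs} (pxs : All Positive xs) → (∀ {A} → A ∈ xs → ∀ p → T A ⇔ T′ A p) →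
                   Any T xs ⇔ Any (uncurry T′) (withProofs pxs)
  Any-withProofs [] _ = mk⇔ (λ ()) (λ ())
  Any-withProofs (p ∷ pxs) T⇔T′ = mk⇔
    (λ { (here t) → here (Equivalence.to (T⇔T′ (here refl) p) t)
       ; (there t) → there (Equivalence.to rest t) })
    (λ { (here t) → here (Equivalence.from (T⇔T′ (here refl) p) t)
       ; (there t) → there (Equivalence.from rest t) })
    where rest = Any-withProofs pxs (λ A∈ → T⇔T′ (there A∈))

infix 3 _⊢_

data _⊢_ (Γ : List Fm) : Fm → Set where
  hyp : A ∈ Γ → Γ ⊢ A
  thm : Int A → Γ ⊢ A
  app : Γ ⊢ A ⇒ B → Γ ⊢ A → Γ ⊢ B

⇒-refl : ∀ A → Int (A ⇒ A)
⇒-refl A = mp (mp (ax2 A (A ⇒ A) A) (ax1 A (A ⇒ A))) (ax1 A A)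

⇒-intro : A ∷ Γ ⊢ B → Γ ⊢ A ⇒ B
⇒-intro {A} (hyp (here refl)) = thm (⇒-refl A)
⇒-intro {A} (hyp (there B∈)) = app (thm (ax1 _ A)) (hyp B∈)
⇒-intro {A} (thm t) = app (thm (ax1 _ A)) (thm t)
⇒-intro {A} (app d e) = app (app (thm (ax2 A _ _)) (⇒-intro d)) (⇒-intro e)

⊢-closed : [] ⊢ A → Int A
⊢-closed (thm t) = t
⊢-closed (app d e) = mp (⊢-closed d) (⊢-closed e)

#0 : A ∷ Γ ⊢ A
#0 = hyp (here refl)

#1 : B ∷ A ∷ Γ ⊢ A
#1 = hyp (there (here refl))

#2 : C ∷ B ∷ A ∷ Γ ⊢ A
#2 = hyp (there (there (here refl)))

⇒-trans : Int (A ⇒ B) → Int (B ⇒ C) → Int (A ⇒ C)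
⇒-trans f g = ⊢-closed (⇒-intro (app (thm g) (app (thm f) #0)))

∨-elim : Int (A ⇒ C) → Int (B ⇒ C) → Int (A ∨' B ⇒ C)
∨-elim f g = mp (mp (ax8 _ _ _) f) g

∧-mono : ∀ {A A′ B B′} → Int (A ⇒ A′) → Int (B ⇒ B′) → Int (A ∧' B ⇒ A′ ∧' B′)
∧-mono f g = ⊢-closed (⇒-intro
  (app (app (thm (ax5 _ _)) (app (thm f) (app (thm (ax3 _ _)) #0))) (app (thm g) (app (thm (ax4 _ _)) #0))))

∨-mono : ∀ {A A′ B B′} → Int (A ⇒ A′) → Int (B ⇒ B′) → Int (A ∨' B ⇒ A′ ∨' B′)
∨-mono f g = ∨-elim (⇒-trans f (ax6 _ _)) (⇒-trans g (ax7 _ _))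

⇒-mono : ∀ {A A′ B B′} → Int (A′ ⇒ A) → Int (B ⇒ B′) → Int ((A ⇒ B) ⇒ A′ ⇒ B′)
⇒-mono f g = ⊢-closed (⇒-intro (⇒-intro (app (thm g) (app #1 (app (thm f) #0)))))

under-∧-intro : Int ((Q ⇒ X) ⇒ (Q ⇒ Y) ⇒ Q ⇒ X ∧' Y)
under-∧-intro = ⊢-closed (⇒-intro (⇒-intro (⇒-intro (app (app (thm (ax5 _ _)) (app #2 #0)) (app #1 #0)))))

under-∨-introˡ : Int ((Q ⇒ X) ⇒ Q ⇒ X ∨' Y)
under-∨-introˡ = ⊢-closed (⇒-intro (⇒-intro (app (thm (ax6 _ _)) (app #1 #0))))

under-⇒-intro : Int ((Q ⇒ Y) ⇒ Q ⇒ X ⇒ Y)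
under-⇒-intro = ⊢-closed (⇒-intro (⇒-intro (⇒-intro (app #2 #1))))

mv : Fm → ℕ
mv (var n) = n
mv (A ∧' B) = mv A ⊔ mv B
mv (A ∨' B) = mv A ⊔ mv B
mv (A ⇒ B) = mv A ⊔ mv B
mv ⊥' = 0

mvList : List Fm → ℕ
mvList [] = 0
mvList (A ∷ As) = mv A ⊔ mvList As

mv≤mvList : ∀ {As} → A ∈ As → mv A ≤ℕ mvList As
mv≤mvList (here refl) = ℕₚ.m≤m⊔n _ _
mv≤mvList {As = B ∷ _} (there A∈) = ℕₚ.≤-trans (mv≤mvList A∈) (ℕₚ.m≤n⊔m (mv B) _)

OnVars : (ℕ → Set) → Fm → Set
OnVars R A = ∀ {n} → n ≤ℕ mv A → R n

module _ {R : ℕ → Set} (A B : Fm) (h : ∀ {n} → n ≤ℕ mv A ⊔ mv B → R n) where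

  onVarsˡ : OnVars R A
  onVarsˡ n≤ = h (ℕₚ.≤-trans n≤ (ℕₚ.m≤m⊔n (mv A) (mv B)))

  onVarsʳ : OnVars R B
  onVarsʳ n≤ = h (ℕₚ.≤-trans n≤ (ℕₚ.m≤n⊔m (mv A) (mv B)))

sub-Positive : ∀ {σ} → PositiveSubst σ → Positive A → Positive (sub σ A)
sub-Positive pσ (var n) = pσ n
sub-Positive pσ (p ∧' q) = sub-Positive pσ p ∧' sub-Positive pσ q
sub-Positive pσ (p ∨' q) = sub-Positive pσ p ∨' sub-Positive pσ q
sub-Positive pσ (p ⇒ q) = sub-Positive pσ p ⇒ sub-Positive pσ q

sub⊥ : Subst → Fm → Fm → Fm
sub⊥ τ Q (var n) = τ n
sub⊥ τ Q (A ∧' B) = sub⊥ τ Q A ∧' sub⊥ τ Q B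
sub⊥ τ Q (A ∨' B) = sub⊥ τ Q A ∨' sub⊥ τ Q B
sub⊥ τ Q (A ⇒ B) = sub⊥ τ Q A ⇒ sub⊥ τ Q B
sub⊥ τ Q ⊥' = Q

sub⊥-Positive : ∀ {τ} → PositiveSubst τ → Positive Q → ∀ A → Positive (sub⊥ τ Q A)
sub⊥-Positive pτ pQ (var n) = pτ n
sub⊥-Positive pτ pQ (A ∧' B) = sub⊥-Positive pτ pQ A ∧' sub⊥-Positive pτ pQ B
sub⊥-Positive pτ pQ (A ∨' B) = sub⊥-Positive pτ pQ A ∨' sub⊥-Positive pτ pQ B
sub⊥-Positive pτ pQ (A ⇒ B) = sub⊥-Positive pτ pQ A ⇒ sub⊥-Positive pτ pQ B
sub⊥-Positive pτ pQ ⊥' = pQ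

sub⊥-positive : ∀ τ Q → Positive A → sub⊥ τ Q A ≡ sub τ A
sub⊥-positive τ Q (var n) = refl
sub⊥-positive τ Q (p ∧' q) = cong₂ _∧'_ (sub⊥-positive τ Q p) (sub⊥-positive τ Q q)
sub⊥-positive τ Q (p ∨' q) = cong₂ _∨'_ (sub⊥-positive τ Q p) (sub⊥-positive τ Q q)
sub⊥-positive τ Q (p ⇒ q) = cong₂ _⇒_ (sub⊥-positive τ Q p) (sub⊥-positive τ Q q)

sub⊥-sub : ∀ τ Q σ A → sub⊥ τ Q (sub σ A) ≡ sub⊥ (sub⊥ τ Q ∘ σ) Q A
sub⊥-sub τ Q σ (var n) = refl
sub⊥-sub τ Q σ (A ∧' B) = cong₂ _∧'_ (sub⊥-sub τ Q σ A) (sub⊥-sub τ Q σ B)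
sub⊥-sub τ Q σ (A ∨' B) = cong₂ _∨'_ (sub⊥-sub τ Q σ A) (sub⊥-sub τ Q σ B)
sub⊥-sub τ Q σ (A ⇒ B) = cong₂ _⇒_ (sub⊥-sub τ Q σ A) (sub⊥-sub τ Q σ B)
sub⊥-sub τ Q σ ⊥' = refl

_⟺_ : Fm → Fm → Set
A ⟺ B = Int (A ⇒ B) × Int (B ⇒ A)

∨-absorb : Int (X ⇒ Y) → (Y ∨' X) ⟺ Y
∨-absorb f = ∨-elim (⇒-refl _) f , ax6 _ _

sub-⟺ : ∀ {ρ} A → OnVars (λ n → ρ n ⟺ var n) A → sub ρ A ⟺ A
sub-⟺ (var n) h = h ℕₚ.≤-refl
sub-⟺ (A ∧' B) h =
  let f , f′ = sub-⟺ A (onVarsˡ A B h); g , g′ = sub-⟺ B (onVarsʳ A B h)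
  in ∧-mono f g , ∧-mono f′ g′
sub-⟺ (A ∨' B) h =
  let f , f′ = sub-⟺ A (onVarsˡ A B h); g , g′ = sub-⟺ B (onVarsʳ A B h)
  in ∨-mono f g , ∨-mono f′ g′
sub-⟺ (A ⇒ B) h =
  let f , f′ = sub-⟺ A (onVarsˡ A B h); g , g′ = sub-⟺ B (onVarsʳ A B h)
  in ⇒-mono f′ g , ⇒-mono f g′
sub-⟺ ⊥' h = ⇒-refl ⊥' , ⇒-refl ⊥'

conjUpTo : ℕ → Fm
conjUpTo zero = var zero
conjUpTo (suc N) = var (suc N) ∧' conjUpTo N

conjUpTo-Positive : ∀ N → Positive (conjUpTo N)
conjUpTo-Positive zero = var zero
conjUpTo-Positive (suc N) = var (suc N) ∧' conjUpTo-Positive N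

conjUpTo-⇒ : ∀ {n} N → n ≤ℕ N → Int (conjUpTo N ⇒ var n)
conjUpTo-⇒ zero z≤n = ⇒-refl _
conjUpTo-⇒ (suc N) n≤1+N with ℕₚ.m≤n⇒m<n∨m≡n n≤1+N
... | inj₁ (s≤s n≤N) = ⇒-trans (ax4 _ _) (conjUpTo-⇒ N n≤N)
... | inj₂ refl = ax3 _ _

-- var 0 plays the fresh variable Q; all other variables are shifted up by one.
⊥≔var₀ : Fm → Fm
⊥≔var₀ = sub⊥ (λ n → var (suc n) ∨' var 0) (var 0)

⊥≔var₀-Positive : ∀ A → Positive (⊥≔var₀ A)
⊥≔var₀-Positive = sub⊥-Positive (λ n → var (suc n) ∨' var 0) (var 0)

⊥≔var₀-sub : ∀ σ → Positive A → sub (⊥≔var₀ ∘ σ) A ≡ ⊥≔var₀ (sub σ A)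
⊥≔var₀-sub {A} σ pA = ≡.trans (≡.sym (sub⊥-positive _ _ pA)) (≡.sym (sub⊥-sub _ _ σ A))

var₀≔⊥ : Subst
var₀≔⊥ zero = ⊥'
var₀≔⊥ (suc n) = var n

var₀≔⊥-⊥≔var₀ : ∀ A → sub var₀≔⊥ (⊥≔var₀ A) ≡ sub (λ n → var n ∨' ⊥') A
var₀≔⊥-⊥≔var₀ (var n) = refl
var₀≔⊥-⊥≔var₀ (A ∧' B) = cong₂ _∧'_ (var₀≔⊥-⊥≔var₀ A) (var₀≔⊥-⊥≔var₀ B)
var₀≔⊥-⊥≔var₀ (A ∨' B) = cong₂ _∨'_ (var₀≔⊥-⊥≔var₀ A) (var₀≔⊥-⊥≔var₀ B)
var₀≔⊥-⊥≔var₀ (A ⇒ B) = cong₂ _⇒_ (var₀≔⊥-⊥≔var₀ A) (var₀≔⊥-⊥≔var₀ B)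
var₀≔⊥-⊥≔var₀ ⊥' = refl

IntPlus-⊥≔var₀⁻ : ∀ {P} → IntPlus P (⊥≔var₀ A) → IntPlus P A
IntPlus-⊥≔var₀⁻ {A} d = mp (int (proj₁ (sub-⟺ A (λ _ → ∨-absorb (ax9 _)))))
  (≡.subst (IntPlus _) (var₀≔⊥-⊥≔var₀ A) (subst var₀≔⊥ d))

module _ {P : Fm → Set} (PL : PositiveLogic P) where
  open PositiveLogic PL

  Int⁺⊆ : Int A → Positive A → P A
  Int⁺⊆ t pA = containsInt⁺ _ (t , pA)

  mp-Int₁ : Int (A ⇒ B) → Positive B → P A → P B
  mp-Int₁ t pB a = closedMP _ _ (Int⁺⊆ t (positive _ a ⇒ pB)) a

  mp-Int₂ : Int (A ⇒ B ⇒ C) → Positive C → P A → P B → P C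
  mp-Int₂ t pC a b = closedMP _ _ (mp-Int₁ t (positive _ b ⇒ pC) a) b

  module _ {τ : Subst} (pτ : PositiveSubst τ) (pQ : Positive Q) (Q⇒τ : ∀ n → P (Q ⇒ τ n)) where

    private
      pos : ∀ A → Positive (sub⊥ τ Q A)
      pos = sub⊥-Positive pτ pQ

    Q⇒sub⊥ : ∀ A → P (Q ⇒ sub⊥ τ Q A)
    Q⇒sub⊥ (var n) = Q⇒τ n
    Q⇒sub⊥ (A ∧' B) = mp-Int₂ under-∧-intro (pQ ⇒ pos (A ∧' B)) (Q⇒sub⊥ A) (Q⇒sub⊥ B)
    Q⇒sub⊥ (A ∨' B) = mp-Int₁ under-∨-introˡ (pQ ⇒ pos (A ∨' B)) (Q⇒sub⊥ A)
    Q⇒sub⊥ (A ⇒ B) = mp-Int₁ under-⇒-intro (pQ ⇒ pos (A ⇒ B)) (Q⇒sub⊥ B)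
    Q⇒sub⊥ ⊥' = Int⁺⊆ (⇒-refl _) (pQ ⇒ pQ)

    Int-sub⊥ : Int A → P (sub⊥ τ Q A)
    Int-sub⊥ (ax1 A B) = Int⁺⊆ (ax1 _ _) (pos (A ⇒ B ⇒ A))
    Int-sub⊥ (ax2 A B C) = Int⁺⊆ (ax2 _ _ _) (pos ((A ⇒ B ⇒ C) ⇒ (A ⇒ B) ⇒ A ⇒ C))
    Int-sub⊥ (ax3 A B) = Int⁺⊆ (ax3 _ _) (pos (A ∧' B ⇒ A))
    Int-sub⊥ (ax4 A B) = Int⁺⊆ (ax4 _ _) (pos (A ∧' B ⇒ B))
    Int-sub⊥ (ax5 A B) = Int⁺⊆ (ax5 _ _) (pos (A ⇒ B ⇒ A ∧' B))
    Int-sub⊥ (ax6 A B) = Int⁺⊆ (ax6 _ _) (pos (A ⇒ A ∨' B))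
    Int-sub⊥ (ax7 A B) = Int⁺⊆ (ax7 _ _) (pos (B ⇒ A ∨' B))
    Int-sub⊥ (ax8 A B C) = Int⁺⊆ (ax8 _ _ _) (pos ((A ⇒ C) ⇒ (B ⇒ C) ⇒ A ∨' B ⇒ C))
    Int-sub⊥ (ax9 A) = Q⇒sub⊥ A
    Int-sub⊥ (mp t u) = closedMP _ _ (Int-sub⊥ t) (Int-sub⊥ u)

  IntPlus-sub⊥ : IntPlus P A → ∀ {τ} → PositiveSubst τ → Positive Q → (∀ n → P (Q ⇒ τ n)) → P (sub⊥ τ Q A)
  IntPlus-sub⊥ (int t) pτ pQ Q⇒τ = Int-sub⊥ pτ pQ Q⇒τ t
  IntPlus-sub⊥ (extra {A} a) {τ} pτ pQ Q⇒τ =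
    ≡.subst P (≡.sym (sub⊥-positive τ _ (positive A a))) (closedSubst τ pτ A a)
  IntPlus-sub⊥ (mp d e) pτ pQ Q⇒τ = closedMP _ _ (IntPlus-sub⊥ d pτ pQ Q⇒τ) (IntPlus-sub⊥ e pτ pQ Q⇒τ)
  IntPlus-sub⊥ (subst σ {A} d) {τ} pτ pQ Q⇒τ = ≡.subst P (≡.sym (sub⊥-sub τ _ σ A))
    (IntPlus-sub⊥ d (λ n → sub⊥-Positive pτ pQ (σ n)) pQ (λ n → Q⇒sub⊥ pτ pQ Q⇒τ (σ n)))

  IntPlus-sub⊥-∨ : ∀ {τ} → IntPlus P A → PositiveSubst τ → Positive Q → P (sub⊥ (λ n → τ n ∨' Q) Q A)
  IntPlus-sub⊥-∨ d pτ pQ = IntPlus-sub⊥ d (λ n → pτ n ∨' pQ) pQ (λ n → Int⁺⊆ (ax7 _ _) (pQ ⇒ pτ n ∨' pQ))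

  IntPlus-conservative : Positive A → IntPlus P A → P A
  IntPlus-conservative {A} pA d = mp-Int₁ (proj₁ (sub-⟺ A (∨-absorb ∘ conjUpTo-⇒ (mv A)))) pA
    (≡.subst P (sub⊥-positive _ _ pA) (IntPlus-sub⊥-∨ d var (conjUpTo-Positive (mv A))))

  Admissible⇒PAdmissible : ∀ r → PositiveRule r → AdmissibleFor (IntPlus P) r → PAdmissible P r
  Admissible⇒PAdmissible r pr@(_ , pcs) adm = pr , λ σ pσ as →
    Any-map∈ (λ B∈ → IntPlus-conservative (sub-Positive pσ (All.lookup pcs B∈))) (adm σ (All.map extra as))

  PAdmissible⇒Admissible : ∀ r → PAdmissible P r → AdmissibleFor (IntPlus P) r
  PAdmissible⇒Admissible r ((pps , pcs) , adm) σ ds =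
    Any-map∈ (λ B∈ → IntPlus-⊥≔var₀⁻ ∘ extra ∘ ≡.subst P (⊥≔var₀-sub σ (All.lookup pcs B∈)))
      (adm (⊥≔var₀ ∘ σ) (⊥≔var₀-Positive ∘ σ)
        (All-map∈ (λ A∈ → ≡.subst P (≡.sym (⊥≔var₀-sub σ (All.lookup pps A∈))) ∘ ⊥≔var₀-sound) ds))
    where
    ⊥≔var₀-sound : IntPlus P A → P (⊥≔var₀ A)
    ⊥≔var₀-sound d = IntPlus-sub⊥-∨ d (λ n → var (suc n)) (var 0)

HHolds : (H : Heyting) → (ℕ → HeytingAlgebra.Carrier H) → Rule → Set
HHolds H v r = All (λ A → ⟦_⟧H H A v ≈ ⊤) (prem r) → Any (λ B → ⟦_⟧H H B v ≈ ⊤) (concl r)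
  where open HeytingAlgebra H

BHolds : (B : BrouwerianAlgebra) → (ℕ → BrouwerianAlgebra.Carrier B) → (r : Rule) → PositiveRule r → Set
BHolds B v r (pps , pcs) =
  All (λ x → ⟦_⟧B B (proj₁ x) (proj₂ x) v ≈ ⊤) (withProofs pps) →
  Any (λ x → ⟦_⟧B B (proj₁ x) (proj₂ x) v ≈ ⊤) (withProofs pcs)
  where open BrouwerianAlgebra B

module _ (H : Heyting) where
  open HeytingAlgebra H renaming (refl to ≤-refl; trans to ≤-trans)
  open import Relation.Binary.Lattice.Properties.HeytingAlgebra H using (y≤x⇨y; ⇨-distribˡ-∨-∧-≥)

  private
    ⟦_⟧ : Fm → (ℕ → Carrier) → Carrier
    ⟦_⟧ = ⟦_⟧H H

  ⊤≤⇨ : ∀ {x y} → x ≤ y → ⊤ ≤ x ⇨ y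
  ⊤≤⇨ x≤y = transpose-⇨ (≤-trans (x∧y≤y _ _) x≤y)

  ≤-mp : ∀ {w x y} → w ≤ x ⇨ y → w ≤ x → w ≤ y
  ≤-mp w≤x⇨y w≤x = ≤-trans (∧-greatest ≤-refl w≤x) (transpose-∧ w≤x⇨y)

  ⇨-S : ∀ {x y z} → x ⇨ y ⇨ z ≤ (x ⇨ y) ⇨ x ⇨ z
  ⇨-S = transpose-⇨ (transpose-⇨ (≤-mp (≤-mp (≤-trans (x∧y≤x _ _) (x∧y≤x _ _)) (x∧y≤y _ _))
                                         (≤-mp (≤-trans (x∧y≤x _ _) (x∧y≤y _ _)) (x∧y≤y _ _))))

  Int-sound : Int A → ∀ v → ⊤ ≤ ⟦ A ⟧ v
  Int-sound (ax1 _ _) v = ⊤≤⇨ y≤x⇨y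
  Int-sound (ax2 _ _ _) v = ⊤≤⇨ ⇨-S
  Int-sound (ax3 _ _) v = ⊤≤⇨ (x∧y≤x _ _)
  Int-sound (ax4 _ _) v = ⊤≤⇨ (x∧y≤y _ _)
  Int-sound (ax5 _ _) v = ⊤≤⇨ (transpose-⇨ ≤-refl)
  Int-sound (ax6 _ _) v = ⊤≤⇨ (x≤x∨y _ _)
  Int-sound (ax7 _ _) v = ⊤≤⇨ (y≤x∨y _ _)
  Int-sound (ax8 _ _ _) v = ⊤≤⇨ (transpose-⇨ (⇨-distribˡ-∨-∧-≥ _ _ _))
  Int-sound (ax9 _) v = ⊤≤⇨ (minimum _)
  Int-sound (mp t u) v = ≤-mp (Int-sound t v) (Int-sound u v)

  ⟦sub⟧ : ∀ σ A v → ⟦ sub σ A ⟧ v ≡ ⟦ A ⟧ (λ n → ⟦ σ n ⟧ v)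
  ⟦sub⟧ σ (var n) v = refl
  ⟦sub⟧ σ (A ∧' B) v = cong₂ _∧_ (⟦sub⟧ σ A v) (⟦sub⟧ σ B v)
  ⟦sub⟧ σ (A ∨' B) v = cong₂ _∨_ (⟦sub⟧ σ A v) (⟦sub⟧ σ B v)
  ⟦sub⟧ σ (A ⇒ B) v = cong₂ _⇨_ (⟦sub⟧ σ A v) (⟦sub⟧ σ B v)
  ⟦sub⟧ σ ⊥' v = refl

  IntPlus-sound : ∀ {P} → (∀ A → P A → HValidFm H A) → IntPlus P A → ∀ v → ⊤ ≤ ⟦ A ⟧ v
  IntPlus-sound H⊨P (int t) v = Int-sound t v
  IntPlus-sound H⊨P (extra {A} a) v = reflexive (Eq.sym (H⊨P A a v))
  IntPlus-sound H⊨P (mp d e) v = ≤-mp (IntPlus-sound H⊨P d v) (IntPlus-sound H⊨P e v)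
  IntPlus-sound H⊨P (subst σ {A} d) v =
    ≡.subst (⊤ ≤_) (≡.sym (⟦sub⟧ σ A v)) (IntPlus-sound H⊨P d (λ n → ⟦ σ n ⟧ v))

  InVL-intro : ∀ {P} → (∀ A → P A → HValidFm H A) → InVL P H
  InVL-intro H⊨P A d v = antisym (maximum _) (IntPlus-sound H⊨P d v)

module _ (B : BrouwerianAlgebra) where
  open BrouwerianAlgebra B
  open IsBrouwerianAlgebra isBrouwerianAlgebra
  open IsLattice isLattice renaming (refl to ≤-refl; trans to ≤-trans)

  ⟦⟧B-cong : ∀ A (p : Positive A) {u u′} → OnVars (λ n → u n ≡ u′ n) A → ⟦_⟧B B A p u ≡ ⟦_⟧B B A p u′
  ⟦⟧B-cong (var n) (var .n) u≡u′ = u≡u′ ℕₚ.≤-refl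
  ⟦⟧B-cong (A ∧' C) (p ∧' q) u≡u′ = cong₂ _∧_ (⟦⟧B-cong A p (onVarsˡ A C u≡u′)) (⟦⟧B-cong C q (onVarsʳ A C u≡u′))
  ⟦⟧B-cong (A ∨' C) (p ∨' q) u≡u′ = cong₂ _∨_ (⟦⟧B-cong A p (onVarsˡ A C u≡u′)) (⟦⟧B-cong C q (onVarsʳ A C u≡u′))
  ⟦⟧B-cong (A ⇒ C) (p ⇒ q) u≡u′ = cong₂ _⇨_ (⟦⟧B-cong A p (onVarsˡ A C u≡u′)) (⟦⟧B-cong C q (onVarsʳ A C u≡u′))

  y≤x⇨y : ∀ {x y} → y ≤ (x ⇨ y)
  y≤x⇨y = proj₁ (exponential _ _ _) (x∧y≤x _ _)

  ↑_ : Carrier → Heyting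
  ↑ g = record
    { Carrier = Σ Carrier (g ≤_)
    ; _≈_ = λ x y → proj₁ x ≈ proj₁ y
    ; _≤_ = λ x y → proj₁ x ≤ proj₁ y
    ; _∨_ = λ (x , g≤x) (y , _) → x ∨ y , ≤-trans g≤x (x≤x∨y _ _)
    ; _∧_ = λ (x , g≤x) (y , g≤y) → x ∧ y , ∧-greatest g≤x g≤y
    ; _⇨_ = λ (x , _) (y , g≤y) → x ⇨ y , ≤-trans g≤y y≤x⇨y
    ; ⊤ = ⊤ , maximum g
    ; ⊥ = g , ≤-refl
    ; isHeytingAlgebra = record
      { isBoundedLattice = record
        { isLattice = record
          { isPartialOrder = On.isPartialOrder proj₁ isPartialOrder
          ; supremum = λ _ _ → x≤x∨y _ _ , y≤x∨y _ _ , λ _ → ∨-least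
          ; infimum = λ _ _ → x∧y≤x _ _ , x∧y≤y _ _ , λ _ → ∧-greatest
          }
        ; maximum = λ x → maximum (proj₁ x)
        ; minimum = proj₂
        }
      ; exponential = λ w x y → exponential (proj₁ w) (proj₁ x) (proj₁ y)
      }
    }

  meetUpTo : (ℕ → Carrier) → ℕ → Carrier
  meetUpTo v zero = v zero
  meetUpTo v (suc N) = v (suc N) ∧ meetUpTo v N

  meetUpTo-≤ : ∀ v {n} N → n ≤ℕ N → meetUpTo v N ≤ v n
  meetUpTo-≤ v zero z≤n = ≤-refl
  meetUpTo-≤ v (suc N) n≤1+N with ℕₚ.m≤n⇒m<n∨m≡n n≤1+N
  ... | inj₁ (s≤s n≤N) = ≤-trans (x∧y≤y _ _) (meetUpTo-≤ v N n≤N)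
  ... | inj₂ refl = x∧y≤x _ _

  clip : (v : ℕ → Carrier) (N : ℕ) → ℕ → HeytingAlgebra.Carrier (↑ meetUpTo v N)
  clip v N n with n ≤? N
  ... | yes n≤N = v n , meetUpTo-≤ v N n≤N
  ... | no _ = meetUpTo v N , ≤-refl

  clip-agrees : ∀ v N {n} → n ≤ℕ N → v n ≡ proj₁ (clip v N n)
  clip-agrees v N {n} n≤N with n ≤? N
  ... | yes _ = refl
  ... | no n≰N = contradiction n≤N n≰N

reduct : Heyting → BrouwerianAlgebra
reduct H = record
  { Carrier = Carrier ; _≈_ = _≈_ ; _≤_ = _≤_ ; _∨_ = _∨_ ; _∧_ = _∧_ ; _⇨_ = _⇨_ ; ⊤ = ⊤
  ; isBrouwerianAlgebra = record { isLattice = isLattice ; maximum = maximum ; exponential = exponential }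
  }
  where open HeytingAlgebra H

module _ (H : Heyting) (B : BrouwerianAlgebra) where
  private
    module H = HeytingAlgebra H
    module B = BrouwerianAlgebra B

  record PositiveHomomorphism : Set where
    field
      fun    : H.Carrier → B.Carrier
      ∧-homo : ∀ x y → fun (x H.∧ y) ≡ fun x B.∧ fun y
      ∨-homo : ∀ x y → fun (x H.∨ y) ≡ fun x B.∨ fun y
      ⇨-homo : ∀ x y → fun (x H.⇨ y) ≡ fun x B.⇨ fun y
      ⊤-iff  : ∀ x → (x H.≈ H.⊤) ⇔ (fun x B.≈ B.⊤)

reduct-homomorphism : (H : Heyting) → PositiveHomomorphism H (reduct H)
reduct-homomorphism H = record
  { fun = id ; ∧-homo = λ _ _ → refl ; ∨-homo = λ _ _ → refl ; ⇨-homo = λ _ _ → refl ; ⊤-iff = λ _ → ⇔.refl }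

proj₁-homomorphism : (B : BrouwerianAlgebra) (g : BrouwerianAlgebra.Carrier B) → PositiveHomomorphism (↑_ B g) B
proj₁-homomorphism B g = record
  { fun = proj₁ ; ∧-homo = λ _ _ → refl ; ∨-homo = λ _ _ → refl ; ⇨-homo = λ _ _ → refl ; ⊤-iff = λ _ → ⇔.refl }

module _ {H : Heyting} {B : BrouwerianAlgebra} (φ : PositiveHomomorphism H B) where
  open PositiveHomomorphism φ
  private
    module H = HeytingAlgebra H
    module B = BrouwerianAlgebra B

  ⟦⟧B-fun : ∀ A (p : Positive A) v → ⟦_⟧B B A p (fun ∘ v) ≡ fun (⟦_⟧H H A v)
  ⟦⟧B-fun (var n) (var .n) v = refl
  ⟦⟧B-fun (A ∧' C) (p ∧' q) v = ≡.trans (cong₂ B._∧_ (⟦⟧B-fun A p v) (⟦⟧B-fun C q v)) (≡.sym (∧-homo _ _))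
  ⟦⟧B-fun (A ∨' C) (p ∨' q) v = ≡.trans (cong₂ B._∨_ (⟦⟧B-fun A p v) (⟦⟧B-fun C q v)) (≡.sym (∨-homo _ _))
  ⟦⟧B-fun (A ⇒ C) (p ⇒ q) v = ≡.trans (cong₂ B._⇨_ (⟦⟧B-fun A p v) (⟦⟧B-fun C q v)) (≡.sym (⇨-homo _ _))

  Agrees : (ℕ → H.Carrier) → (ℕ → B.Carrier) → Fm → Set
  Agrees w u = OnVars (λ n → u n ≡ fun (w n))

  ⊤-transfer : ∀ A (p : Positive A) {w u} → Agrees w u A → (⟦_⟧H H A w H.≈ H.⊤) ⇔ (⟦_⟧B B A p u B.≈ B.⊤)
  ⊤-transfer A p {w} u≡fw rewrite ⟦⟧B-cong B A p u≡fw | ⟦⟧B-fun A p w = ⊤-iff (⟦_⟧H H A w)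

  holds-transfer : ∀ r (pr : PositiveRule r) {w u} → (∀ {A} → A ∈ prem r ++ concl r → Agrees w u A) →
                   HHolds H w r ⇔ BHolds B u r pr
  holds-transfer r (pps , pcs) agree = →-cong-⇔
    (All-withProofs pps (λ A∈ p → ⊤-transfer _ p (agree (∈-++⁺ˡ A∈))))
    (Any-withProofs pcs (λ A∈ p → ⊤-transfer _ p (agree (∈-++⁺ʳ (prem r) A∈))))

  BValid⇒HValid : ∀ r (pr : PositiveRule r) → BValid B r pr → HValid H r
  BValid⇒HValid r pr@(_ , _) B⊨r v = Equivalence.from (holds-transfer r pr (λ _ _ → refl)) (B⊨r (fun ∘ v))

HValid⇒BValid-reduct : ∀ H r (pr : PositiveRule r) → HValid H r → BValid (reduct H) r pr
HValid⇒BValid-reduct H r pr@(_ , _) H⊨r v =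
  Equivalence.to (holds-transfer (reduct-homomorphism H) r pr (λ _ _ → refl)) (H⊨r v)

reduct-InVP : ∀ {P} H → InVL P H → InVP P (reduct H)
reduct-InVP H H∈VL A pA a v =
  Equivalence.to (⊤-transfer (reduct-homomorphism H) A pA (λ _ → refl)) (H∈VL A (extra a) v)

↑-InVL : ∀ {P} → (∀ A → P A → Positive A) → ∀ B g → InVP P B → InVL P (↑_ B g)
↑-InVL pos B g B∈VP = InVL-intro (↑_ B g) λ A a u →
  Equivalence.from (⊤-transfer (proj₁-homomorphism B g) A (pos A a) (λ _ → refl)) (B∈VP A (pos A a) a (proj₁ ∘ u))

PFollows⇒LFollows : ∀ {P} ℛ r (pr : PositiveRule r) → PFollows P ℛ r pr → LFollows P ℛ r
PFollows⇒LFollows ℛ r pr P⊢r H H∈VL H⊨ℛ = BValid⇒HValid (reduct-homomorphism H) r pr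
  (P⊢r (reduct H) (reduct-InVP H H∈VL) (λ r′ pr′ r′∈ℛ → HValid⇒BValid-reduct H r′ pr′ (H⊨ℛ r′ r′∈ℛ)))

LFollows⇒PFollows : ∀ {P} → (∀ A → P A → Positive A) → ∀ ℛ → (∀ r → ℛ r → PositiveRule r) →
                    ∀ r (pr : PositiveRule r) → LFollows P ℛ r → PFollows P ℛ r pr
LFollows⇒PFollows pos ℛ ℛ⁺ r pr@(_ , _) L⊢r B B∈VP B⊨ℛ v =
  Equivalence.to (holds-transfer φ r pr agree) (L⊢r (↑_ B g) (↑-InVL pos B g B∈VP) ↑g⊨ℛ (clip B v N))
  where
  N = mvList (prem r ++ concl r)
  g = meetUpTo B v N
  φ = proj₁-homomorphism B g
  agree : ∀ {A} → A ∈ prem r ++ concl r → Agrees φ (clip B v N) v A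
  agree A∈ n≤ = clip-agrees B v N (ℕₚ.≤-trans n≤ (mv≤mvList A∈))
  ↑g⊨ℛ : ∀ r′ → ℛ r′ → HValid (↑_ B g) r′
  ↑g⊨ℛ r′ r′∈ℛ = BValid⇒HValid φ r′ (ℛ⁺ r′ r′∈ℛ) (B⊨ℛ r′ (ℛ⁺ r′ r′∈ℛ) r′∈ℛ)

mainTheorem18 : (P : Fm → Set) → PositiveLogic P →
    (ℛ : Rule → Set) → (∀ r → ℛ r → PositiveRule r) →
    ((LBasis P ℛ → PBasis P ℛ × (LIndependent P ℛ → PIndependent P ℛ))
    × (PBasis P ℛ → ∀ r → PositiveRule r → AdmissibleFor (IntPlus P) r → LFollows P ℛ r))
mainTheorem18 P PL ℛ ℛ⁺ = partI , partII
  where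
  open PositiveLogic PL using (positive)

  partI : LBasis P ℛ → PBasis P ℛ × (LIndependent P ℛ → PIndependent P ℛ)
  partI (ℛ-admissible , ℛ-complete) =
    ( (λ r r∈ℛ → Admissible⇒PAdmissible PL r (ℛ⁺ r r∈ℛ) (ℛ-admissible r r∈ℛ))
    , (λ r adm → LFollows⇒PFollows positive ℛ ℛ⁺ r (proj₁ adm)
                   (ℛ-complete r (PAdmissible⇒Admissible PL r adm))) )
    , λ independent r pr r∈ℛ P⊢r → independent r r∈ℛ (PFollows⇒LFollows (Others ℛ r) r pr P⊢r)

  partII : PBasis P ℛ → ∀ r → PositiveRule r → AdmissibleFor (IntPlus P) r → LFollows P ℛ r
  partII (_ , ℛ-complete) r pr adm =
    PFollows⇒LFollows ℛ r pr (ℛ-complete r (Admissible⇒PAdmissible PL r pr adm))
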